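{- Let $G$ be a connected graph, $Y$ a Gyárfás decomposition of $G$, and $B$ a bag of $Y$ with level $1$. Let $C$ be a connected component of $\overline{G[B]}$ (the complement of $G[B]$), $Y_C$ a Gyárfás decomposition of $C$, and $B'$ a bag of $Y_C$ with level $j\ge 1$. Then $\operatorname{sind}(G[B'])<\operatorname{sind}(G)$.
   Context: The strong index $\operatorname{sind}(G)$ is the maximum $k$ such that $G$ contains distinct vertices $a_1,\dots,a_k,b_1,\dots,b_k$ with: for all $1\le i<j\le k$, $a_i$ adjacent to $b_j$ and $b_i$ not adjacent to $a_j$; $a_1,\dots,a_k$ a clique; $b_1,\dots,b_k$ an independent set. A Gyárfás decomposition of a connected graph $G$ is a rooted tree $Y$ such that: (1) the nodes (bags) are pairwise disjoint non-empty subsets of $V(G)$ with union $V(G)$; (2) the root bag is a single vertex (the initial vertex); (3) if $u\in B$, $u'\in B'$ are adjacent then one of $B,B'$ is an ancestor of the other (each node is its own ancestor); (4) for every bag $B$, the union of $B$ and its descendants induces a connected subgraph; (5) every non-root bag $B$ has a hook $h(B)$ in its parent bag adjacent to all vertices of $B$ and non-adjacent to all vertices in strict descendants of $B$. The level of a bag is the number of edges on the path in $Y$ to the root. -}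

module Defs where

open import Data.Nat using (ℕ; zero; suc; _≥_)
import Data.Nat as ℕ
open import Data.Fin using (Fin)
import Data.Fin as F
open import Data.Product using (Σ; ∃; ∃-syntax; _×_; _,_)
open import Data.Sum using (_⊎_)
open import Data.Unit using (⊤)
open import Relation.Nullary using (¬_)
open import Relation.Binary using (Decidable)
open import Relation.Binary.PropositionalEquality using (_≡_; _≢_)

record Graph : Set₁ where
  field
    n      : ℕ
    E      : Fin n → Fin n → Set
    E?     : Decidable E
    sym    : ∀ {u v} → E u v → E v u
    irrefl : ∀ {u} → ¬ E u u
open Graph public

-- Throughout, a "graph" we reason about is given by an adjacency relation R on
-- Fin n together with a vertex subset S : Fin n → Set; this is the graph
-- induced on S (e.g. G[B] is (E G , B), the complement of G[B] is (Co E , B)).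
VSet : ℕ → Set₁
VSet n = Fin n → Set

Rel : ℕ → Set₁
Rel n = Fin n → Fin n → Set

Co : ∀ {n} → Rel n → Rel n
Co R u v = u ≢ v × ¬ R u v

data Path {n} (R : Rel n) (S : VSet n) : Fin n → Fin n → Set where
  here : ∀ {u} → S u → Path R S u u
  step : ∀ {u v w} → S u → R u v → Path R S v w → Path R S u w

Connected : ∀ {n} → Rel n → VSet n → Set
Connected R S = (∃[ v ] S v) × (∀ u v → S u → S v → Path R S u v)

IsComponent : ∀ {n} → Rel n → VSet n → VSet n → Set
IsComponent R S C =
  (∀ v → C v → S v) × Connected R C × (∀ u v → C u → S v → R u v → C v)

iter : ∀ {A : Set} → (A → A) → ℕ → A → A
iter f zero    x = x
iter f (suc k) x = f (iter f k x)

-- Nodes (bags) are Fin m; vertex v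
-- of S lies in bag (bag v) (so bags are disjoint and cover S); the rooted tree
-- is given by a parent map with par root ≡ root, every node reaching the root.
record Gyarfas {n} (R : Rel n) (S : VSet n) : Set₁ where
  field
    m     : ℕ
    bag   : Fin n → Fin m
    root  : Fin m
    par   : Fin m → Fin m
    par-root : par root ≡ root
    reach : ∀ x → ∃[ d ] iter par d x ≡ root

  Anc : Fin m → Fin m → Set
  Anc a d = ∃[ k ] iter par k d ≡ a

  Bag : Fin m → VSet n
  Bag b v = S v × bag v ≡ b

  Down : Fin m → VSet n
  Down b v = S v × Anc b (bag v)

  StrictDown : Fin m → VSet n
  StrictDown b v = S v × Anc b (bag v) × bag v ≢ b

  Level : Fin m → ℕ → Set
  Level b d = iter par d b ≡ root × (∀ d′ → d′ ℕ.< d → iter par d′ b ≢ root)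

  field
    nonempty : ∀ b → ∃[ v ] Bag b v
    root-single : ∃[ v ] (Bag root v × (∀ w → Bag root w → w ≡ v))
    edges : ∀ u v → S u → S v → R u v → Anc (bag u) (bag v) ⊎ Anc (bag v) (bag u)
    down-connected : ∀ b → Connected R (Down b)
    hook : ∀ b → b ≢ root →
      ∃[ h ] (Bag (par b) h × (∀ v → Bag b v → R h v)
                            × (∀ v → StrictDown b v → ¬ R h v))

HasStrong : ∀ {n} → Rel n → VSet n → ℕ → Set
HasStrong {n} R S k =
  Σ (Fin k → Fin n) λ a → Σ (Fin k → Fin n) λ b →
    (∀ i → S (a i)) × (∀ i → S (b i)) ×
    (∀ i j → a i ≡ a j → i ≡ j) × (∀ i j → b i ≡ b j → i ≡ j) ×
    (∀ i j → a i ≢ b j) ×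
    (∀ i j → i F.< j → R (a i) (b j) × ¬ R (b i) (a j)) ×
    (∀ i j → i ≢ j → R (a i) (a j)) ×
    (∀ i j → i ≢ j → ¬ R (b i) (b j))

IsSind : ∀ {n} → Rel n → VSet n → ℕ → Set
IsSind R S s = HasStrong R S s × (∀ k → HasStrong R S k → k ℕ.≤ s)

AllV : ∀ {n} → VSet n
AllV _ = ⊤

{-# OPTIONS --safe #-}
module Submission where

-- Adjoin to a maximum strong structure (a, b) of G[B′] the pair (h, h′), where
-- h is the hook of B in Y and h′ the hook of B′ in Y_C. Since C ⊆ B, h is
-- adjacent in G to h′ and to all of B′; since h′ is a hook in the complement,
-- it is non-adjacent in G to all of B′. So (h, a) and (h′, b) form a strong
-- structure of G of size sind(G[B′]) + 1.

open import Defs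
open import Data.Nat using (ℕ; _<_; _≥_; s≤s; z≤n; suc)
open import Data.Fin using (Fin; zero; suc)
import Data.Fin as Fin
open import Data.Product using (_×_; _,_; proj₁; proj₂; ∃-syntax)
open import Data.Vec.Functional using (_∷_)
open import Data.Empty using (⊥-elim)
open import Relation.Nullary using (¬_)
open import Relation.Binary using (Symmetric)
open import Relation.Binary.PropositionalEquality using (_≡_; _≢_; refl; cong)
  renaming (sym to ≡-sym)

Pairwise : ∀ {n k} → Rel n → (Fin k → Fin n) → Set
Pairwise P a = ∀ i j → i ≢ j → P (a i) (a j)

pairwise-∷ : ∀ {n k} {P : Rel n} {x} {a : Fin k → Fin n} →
  Symmetric P → (∀ i → P x (a i)) → Pairwise P a → Pairwise P (x ∷ a)
pairwise-∷ _     _  _  zero    zero    i≢j = ⊥-elim (i≢j refl)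
pairwise-∷ _     xa _  zero    (suc j) _   = xa j
pairwise-∷ P-sym xa _  (suc i) zero    _   = P-sym (xa i)
pairwise-∷ _     _  pa (suc i) (suc j) i≢j = pa i j (λ i≡j → i≢j (cong suc i≡j))

∷-injective : ∀ {n k} {x} {a : Fin k → Fin n} →
  (∀ i → x ≢ a i) → (∀ i j → a i ≡ a j → i ≡ j) →
  ∀ i j → (x ∷ a) i ≡ (x ∷ a) j → i ≡ j
∷-injective _   _     zero    zero    _   = refl
∷-injective x∉a _     zero    (suc j) eq  = ⊥-elim (x∉a j eq)
∷-injective x∉a _     (suc i) zero    eq  = ⊥-elim (x∉a i (≡-sym eq))
∷-injective _   a-inj (suc i) (suc j) eq  = cong suc (a-inj i j eq)

module _ (G : Graph) where
  open Graph G using () renaming (sym to E-sym; irrefl to E-irrefl)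

  E⇒≢ : ∀ {u v} → E G u v → u ≢ v
  E⇒≢ e refl = E-irrefl e

  ¬E-sym : Symmetric (λ u v → ¬ E G u v)
  ¬E-sym ¬e e = ¬e (E-sym e)

  hasStrong-∷ : ∀ {S T : VSet (n G)} {k x y} →
    (∀ v → S v → T v) → T x → T y →
    (∀ v → S v → E G x v) → (∀ v → S v → Co (E G) y v) → E G x y →
    HasStrong (E G) S k → HasStrong (E G) T (suc k)
  hasStrong-∷ {S} {T} {x = x} {y} S⊆T Tx Ty x-S y-S xy
    (a , b , Sa , Sb , a-inj , b-inj , a≢b , ordered , a-clique , b-indep) =
    x ∷ a , y ∷ b , T-xa , T-yb
    , ∷-injective (λ i → E⇒≢ (x-S _ (Sa i))) a-inj
    , ∷-injective (λ i → proj₁ (y-S _ (Sb i))) b-inj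
    , xa≢yb , ordered′
    , pairwise-∷ {P = E G} E-sym (λ i → x-S _ (Sa i)) a-clique
    , pairwise-∷ {P = λ u v → ¬ E G u v} ¬E-sym (λ i → proj₂ (y-S _ (Sb i))) b-indep
    where
    T-xa : ∀ i → T ((x ∷ a) i)
    T-xa zero    = Tx
    T-xa (suc i) = S⊆T _ (Sa i)

    T-yb : ∀ i → T ((y ∷ b) i)
    T-yb zero    = Ty
    T-yb (suc i) = S⊆T _ (Sb i)

    xa≢yb : ∀ i j → (x ∷ a) i ≢ (y ∷ b) j
    xa≢yb zero    zero    = E⇒≢ xy
    xa≢yb zero    (suc j) = E⇒≢ (x-S _ (Sb j))
    xa≢yb (suc i) zero    = λ eq → proj₁ (y-S _ (Sa i)) (≡-sym eq)
    xa≢yb (suc i) (suc j) = a≢b i j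

    ordered′ : ∀ i j → i Fin.< j →
      E G ((x ∷ a) i) ((y ∷ b) j) × ¬ E G ((y ∷ b) i) ((x ∷ a) j)
    ordered′ zero    (suc j) _         = x-S _ (Sb j) , proj₂ (y-S _ (Sa j))
    ordered′ (suc i) (suc j) (s≤s i<j) = ordered i j i<j

module _ {n} {R : Rel n} {S : VSet n} (Y : Gyarfas R S) where
  open Gyarfas Y

  level-suc⇒≢root : ∀ {b d} → Level b (suc d) → b ≢ root
  level-suc⇒≢root (_ , below) = below 0 (s≤s z≤n)

  hook-of-level-suc : ∀ {b d} → Level b (suc d) →
    ∃[ h ] Bag (par b) h × (∀ v → Bag b v → R h v)
  hook-of-level-suc level with hook _ (level-suc⇒≢root level)
  ... | h , h∈parent , h-complete , _ = h , h∈parent , h-complete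

lemma4p5 : (G : Graph) → Connected (E G) AllV →
    (Y : Gyarfas (E G) AllV) → (b : Fin (Gyarfas.m Y)) → Gyarfas.Level Y b 1 →
    (C : Fin (n G) → Set) → IsComponent (Co (E G)) (Gyarfas.Bag Y b) C →
    (YC : Gyarfas (Co (E G)) C) → (b′ : Fin (Gyarfas.m YC)) →
    (j : ℕ) → j ≥ 1 → Gyarfas.Level YC b′ j →
    (s s′ : ℕ) → IsSind (E G) AllV s → IsSind (E G) (Gyarfas.Bag YC b′) s′ →
    s′ < s
lemma4p5 G _ Y b level-b C (C⊆B , _) YC b′ (suc _) _ level-b′ s s′ sind-G (strong-B′ , _)
  with hook-of-level-suc Y level-b | hook-of-level-suc YC level-b′
... | h , _ , h-B | h′ , (h′∈C , _) , h′-B′ =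
  proj₂ sind-G (suc s′)
    (hasStrong-∷ G {S = Gyarfas.Bag YC b′} {T = AllV} _ _ _
      (λ v B′v → h-B v (C⊆B v (proj₁ B′v))) h′-B′ (h-B h′ (C⊆B h′ h′∈C))
      strong-B′)
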